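{- Let $n\ge 3$ and $N\ge 2$ be integers with $\gcd(n,N)=1$, and define $h:(\mathbb{Z}/N\mathbb{Z})^\times\to\mathbb{N}$ by $h(a)=\lfloor na/N\rfloor$, where $a$ is taken to be its representative in $\{1,\dots,N-1\}$. For $s\in(\mathbb{Z}/N\mathbb{Z})^\times$ let $\theta_s$ be multiplication by $s$. Then $h\circ\theta_s=h$ if and only if $s=1$. -}

module Defs where

open import Data.Nat using (ℕ; _*_; _≤_; _<_; NonZero)
open import Data.Nat.DivMod using (_/_; _%_)
open import Data.Nat.Coprimality using (Coprime)
open import Data.Product using (_×_)

-- a ∈ {1,…,N-1} with gcd(a,N)=1 : the canonical representative of a unit of ℤ/Nℤ
IsUnitRep : ℕ → ℕ → Set
IsUnitRep N a = 1 ≤ a × a < N × Coprime a N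

θ : (N : ℕ) .{{_ : NonZero N}} → ℕ → ℕ → ℕ
θ N s a = (s * a) % N

h : (n N : ℕ) .{{_ : NonZero N}} → ℕ → ℕ
h n N a = (n * a) / N

{-# OPTIONS --safe #-}
module Submission where

-- Write s = 1 + t, g = gcd(t, N) and M = N / g. Invariance at a = 1 forces n s < N, so n < M.
-- Since s a ≡ a + t a (mod N), and t a runs through all d g with d a unit modulo M as a runs
-- through the units modulo N, it suffices to find a unit d modulo M with M/n ≤ d ≤ M − M/n:
-- adding d g to a then moves n a past a multiple of N, upwards, or downwards after wrapping
-- around N, so h changes. Such a d lies near M/2 unless (M, n) is (4, 3), (6, 5) or (10, 3);
-- there g must be even and an explicit unit a near N/2 does the job.

open import Defs
open import Data.Nat using (ℕ; _≤_; NonZero)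
open import Data.Nat.Coprimality using (Coprime)
open import Relation.Binary.PropositionalEquality using (_≡_)
open import Function.Bundles using (_⇔_)

open import Data.Empty using (⊥; ⊥-elim)
open import Data.List using (_∷_; [])
open import Data.Nat
open import Data.Nat.Coprimality
  using (gcd≡1⇒coprime; coprime-divisor; coprime-/gcd; coprime-Bézout)
  renaming (sym to coprime-sym)
open import Data.Nat.DivMod
open import Data.Nat.Divisibility
open import Data.Nat.GCD using (gcd; gcd[m,n]∣m; gcd[m,n]∣n; gcd[m,n]≢0; m/gcd[m,n]≢0; module Bézout)
open import Data.Nat.Induction using (<-rec)
open import Data.Nat.Properties
open import Data.Nat.Tactic.RingSolver using (solve)
open import Data.Product using (∃; ∃₂; _×_; _,_)
open import Data.Sum using (_⊎_; inj₁; inj₂)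
open import Function.Base using (_∘_; _$_)
open import Function.Bundles using (mk⇔)
open import Relation.Nullary using (¬_; yes; no; contradiction)
open import Relation.Binary.PropositionalEquality

Invariant : (n N : ℕ) .{{_ : NonZero N}} → ℕ → Set
Invariant n N s = ∀ a → IsUnitRep N a → h n N (θ N s a) ≡ h n N a

record Counterexample (n N : ℕ) .{{_ : NonZero N}} (s : ℕ) : Set where
  constructor counterexample
  field
    point  : ℕ
    unit   : IsUnitRep N point
    moved  : h n N (θ N s point) ≢ h n N point

counterexample⇒¬invariant : ∀ {n N s} .{{_ : NonZero N}} →
                            Counterexample n N s → ¬ Invariant n N s
counterexample⇒¬invariant (counterexample a a-unit moved) inv = moved (inv a a-unit)

≤-by : ∀ {m n} k → m + k ≡ n → m ≤ n
≤-by {m} k refl = m≤m+n m k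

/-≢-across : ∀ {N} .{{_ : NonZero N}} {x z} q → x < q * N → q * N ≤ z → x / N ≢ z / N
/-≢-across {N} {z = z} q x<qN qN≤z x/N≡z/N =
  <-irrefl x/N≡z/N (<-≤-trans (m<n*o⇒m/o<n x<qN) q≤z/N)
  where
  q≤z/N : q ≤ z / N
  q≤z/N = subst (_≤ z / N) (m*n/n≡m q N) (/-monoˡ-≤ N qN≤z)

/-≢-if-+≤ : ∀ {N} .{{_ : NonZero N}} {x z} → x + N ≤ z → x / N ≢ z / N
/-≢-if-+≤ {N} {x} x+N≤z = /-≢-across (suc (x / N)) x<[1+x/N]*N (≤-trans [1+x/N]*N≤x+N x+N≤z)
  where
  x<[1+x/N]*N : x < suc (x / N) * N
  x<[1+x/N]*N = subst (_< N + x / N * N) (sym (m≡m%n+[m/n]*n x N))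
                  (+-monoˡ-< (x / N * N) (m%n<n x N))
  [1+x/N]*N≤x+N : suc (x / N) * N ≤ x + N
  [1+x/N]*N≤x+N = ≤-trans (+-monoʳ-≤ N (m/n*n≤m x N)) (≤-reflexive (+-comm N x))

h-jump-≢ : ∀ n N .{{_ : NonZero N}} {a D E} → D + E ≡ N → a < N → N ≤ n * D → N ≤ n * E →
           h n N ((a + D) % N) ≢ h n N a
h-jump-≢ n N {a} {D} {E} D+E≡N a<N N≤nD N≤nE with E ≤? a
... | no E≰a = λ eq → /-≢-if-+≤ rise (sym (trans (cong (h n N) (sym (m<n⇒m%n≡m a+D<N))) eq))
  where
  a+D<N : a + D < N
  a+D<N = subst (a + D <_) (trans (+-comm E D) D+E≡N) (+-monoˡ-< D (≰⇒> E≰a))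
  rise : n * a + N ≤ n * (a + D)
  rise = subst (n * a + N ≤_) (sym (*-distribˡ-+ n a D)) (+-monoʳ-≤ (n * a) N≤nD)
... | yes E≤a = λ eq → /-≢-if-+≤ fall (trans (cong (h n N) (sym wrap)) eq)
  where
  y = a ∸ E
  a≡y+E : a ≡ y + E
  a≡y+E = sym (m∸n+n≡m E≤a)
  wrap : (a + D) % N ≡ y
  wrap = begin
    (a + D) % N        ≡⟨ cong (λ x → (x + D) % N) a≡y+E ⟩
    (y + E + D) % N    ≡⟨ cong (_% N) (+-assoc y E D) ⟩
    (y + (E + D)) % N  ≡⟨ cong (λ x → (y + x) % N) (trans (+-comm E D) D+E≡N) ⟩
    (y + N) % N        ≡⟨ [m+n]%n≡m%n y N ⟩
    y % N              ≡⟨ m<n⇒m%n≡m (≤-<-trans (m∸n≤m a E) a<N) ⟩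
    y                  ∎
    where open ≡-Reasoning
  fall : n * y + N ≤ n * a
  fall = begin
    n * y + N      ≤⟨ +-monoʳ-≤ (n * y) N≤nE ⟩
    n * y + n * E  ≡⟨ sym (*-distribˡ-+ n y E) ⟩
    n * (y + E)    ≡⟨ cong (n *_) (sym a≡y+E) ⟩
    n * a          ∎
    where open ≤-Reasoning

θ-suc : ∀ N .{{_ : NonZero N}} {t a D} → (t * a) % N ≡ D % N → θ N (suc t) a ≡ (a + D) % N
θ-suc N {t} {a} {D} ta≡D = begin
  (a + t * a) % N            ≡⟨ %-distribˡ-+ a (t * a) N ⟩
  (a % N + (t * a) % N) % N  ≡⟨ cong (λ x → (a % N + x) % N) ta≡D ⟩
  (a % N + D % N) % N        ≡⟨ sym (%-distribˡ-+ a D N) ⟩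
  (a + D) % N                ∎
  where open ≡-Reasoning

counterexample-by-jump : ∀ {n N t a D E} .{{_ : NonZero N}} → IsUnitRep N a →
                         (t * a) % N ≡ D % N → D + E ≡ N → N ≤ n * D → N ≤ n * E →
                         Counterexample n N (suc t)
counterexample-by-jump {n} {N} {t} {a} a-unit@(_ , a<N , _) ta≡D D+E≡N N≤nD N≤nE =
  counterexample a a-unit $
    subst (λ x → h n N x ≢ h n N a) (sym (θ-suc N {t} ta≡D)) (h-jump-≢ n N D+E≡N a<N N≤nD N≤nE)

counterexample-by-drop : ∀ {n N s} .{{_ : NonZero N}} a y k q → IsUnitRep N a →
                         s * a ≡ y + k * N → y < N → n * y < q * N → q * N ≤ n * a →
                         Counterexample n N s
counterexample-by-drop {n} {N} {s} a y k q a-unit sa≡y+kN y<N ny<qN qN≤na =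
  counterexample a a-unit λ eq → /-≢-across q ny<qN qN≤na (trans (cong (h n N) (sym θsa≡y)) eq)
  where
  θsa≡y : θ N s a ≡ y
  θsa≡y = trans (cong (_% N) sa≡y+kN) (trans ([m+kn]%n≡m%n y k N) (m<n⇒m%n≡m y<N))

coprime-1ʳ : ∀ {d} → Coprime d 1
coprime-1ʳ (_ , e∣1) = ∣1⇒≡1 e∣1

coprime-∣ˡ : ∀ {a b e} → e ∣ a → Coprime a b → Coprime e b
coprime-∣ˡ e∣a a⊥b (f∣e , f∣b) = a⊥b (∣-trans f∣e e∣a , f∣b)

coprime-∣ʳ : ∀ {a b e} → e ∣ b → Coprime a b → Coprime a e
coprime-∣ʳ e∣b a⊥b (f∣a , f∣e) = a⊥b (f∣a , ∣-trans f∣e e∣b)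

coprime-*ʳ : ∀ {a x y} → Coprime a x → Coprime a y → Coprime a (x * y)
coprime-*ʳ a⊥x a⊥y (e∣a , e∣xy) = a⊥y (e∣a , coprime-divisor (coprime-∣ˡ e∣a a⊥x) e∣xy)

coprime-*ˡ : ∀ {x y b} → Coprime x b → Coprime y b → Coprime (x * y) b
coprime-*ˡ x⊥b y⊥b = coprime-sym (coprime-*ʳ (coprime-sym x⊥b) (coprime-sym y⊥b))

coprime-^ʳ : ∀ {a x} → Coprime a x → ∀ i → Coprime a (x ^ i)
coprime-^ʳ a⊥x zero    = coprime-1ʳ
coprime-^ʳ a⊥x (suc i) = coprime-*ʳ a⊥x (coprime-^ʳ a⊥x i)

coprime-*+ : ∀ {d r} q → Coprime d r → Coprime d (q * d + r)
coprime-*+ q d⊥r (e∣d , e∣qd+r) = d⊥r (e∣d , ∣m+n∣m⇒∣n e∣qd+r (∣n⇒∣m*n q e∣d))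

coprime-complement : ∀ {d e M} → d + e ≡ M → Coprime d M → Coprime e M
coprime-complement {d} {e} refl d⊥M {f} (f∣e , f∣M) =
  d⊥M (∣m+n∣m⇒∣n (subst (f ∣_) (+-comm d e) f∣M) f∣e , f∣M)

odd⊥2 : ∀ x → Coprime (1 + 2 * x) 2
odd⊥2 x = coprime-sym (subst (Coprime 2) (trans (+-comm (x * 2) 1) (cong (1 +_) (*-comm x 2)))
                                        (coprime-*+ x coprime-1ʳ))

∣1+n∣n⇒≡1 : ∀ {e n} → e ∣ 1 + n → e ∣ n → e ≡ 1
∣1+n∣n⇒≡1 {e} {n} e∣1+n e∣n = ∣1⇒≡1 (∣m+n∣m⇒∣n (subst (e ∣_) (+-comm 1 n) e∣1+n) e∣n)

-- Divide out gcd(r, c) until it is 1.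
∣-^*coprime : ∀ c r → r ≢ 0 → ∃₂ λ i k → Coprime k c × r ∣ c ^ i * k
∣-^*coprime c = <-rec _ peel
  where
  peel : ∀ r → (∀ {r′} → r′ < r → r′ ≢ 0 → ∃₂ λ i k → Coprime k c × r′ ∣ c ^ i * k) →
         r ≢ 0 → ∃₂ λ i k → Coprime k c × r ∣ c ^ i * k
  peel r rec r≢0 with gcd r c ≟ 1
  ... | yes g≡1 = 0 , r , gcd≡1⇒coprime g≡1 , ∣-reflexive (sym (*-identityˡ r))
  ... | no g≢1 = extend (rec (m/n<m r g 1<g) (m/gcd[m,n]≢0 r c))
    where
    g = gcd r c
    instance
      r-nonZero : NonZero r
      r-nonZero = ≢-nonZero r≢0
      g-nonZero : NonZero g
      g-nonZero = ≢-nonZero (gcd[m,n]≢0 r c (inj₁ r≢0))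
    1<g : 1 < g
    1<g = ≤∧≢⇒< (n≢0⇒n>0 (≢-nonZero⁻¹ g)) (g≢1 ∘ sym)
    extend : (∃₂ λ i k → Coprime k c × r / g ∣ c ^ i * k) → ∃₂ λ i k → Coprime k c × r ∣ c ^ i * k
    extend (i , k , k⊥c , r/g∣cⁱk) =
      suc i , k , k⊥c ,
      subst₂ _∣_ (m*[n/m]≡n (gcd[m,n]∣m r c)) (sym (*-assoc c (c ^ i) k))
             (*-pres-∣ (gcd[m,n]∣n r c) r/g∣cⁱk)

-- With N ∣ c ^ i * k and k coprime to c, a common factor of c + M k and N would divide c or k.
coprime-lift : ∀ {c M N} → Coprime c M → N ≢ 0 → ∃ λ k → Coprime (c + M * k) N
coprime-lift {c} {M} {N} c⊥M N≢0 with ∣-^*coprime c N N≢0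
... | i , k , k⊥c , N∣cⁱk = k , coprime-∣ʳ N∣cⁱk (coprime-*ʳ (coprime-^ʳ x⊥c i) x⊥k)
  where
  x⊥c : Coprime (c + M * k) c
  x⊥c (e∣x , e∣c) = k⊥c (coprime-divisor (coprime-∣ˡ e∣c c⊥M) (∣m+n∣m⇒∣n e∣x e∣c) , e∣c)
  x⊥k : Coprime (c + M * k) k
  x⊥k {e} (e∣x , e∣k) =
    k⊥c (e∣k , ∣m+n∣m⇒∣n (subst (e ∣_) (+-comm c (M * k)) e∣x) (∣n⇒∣m*n M e∣k))

complement-residue : ∀ {P e d M} z → P + e ≡ z * M → d + e ≡ M → e ≢ 0 → ∃ λ w → P ≡ d + w * M
complement-residue {P} zero    P+e≡0 _ e≢0 = ⊥-elim (e≢0 (m+n≡0⇒n≡0 P P+e≡0))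
complement-residue {P} {e} {d} (suc w) P+e≡[1+w]M refl _ =
  w , +-cancelʳ-≡ e P (d + w * (d + e)) (trans P+e≡[1+w]M (solve (d ∷ e ∷ w ∷ [])))

coprime-congruence : ∀ {t M d e} → Coprime t M → Coprime d M → d + e ≡ M → e ≢ 0 →
                     ∃ λ c → Coprime c M × ∃ λ w → t * c ≡ d + w * M
coprime-congruence {t} {M} {d} {e} t⊥M d⊥M d+e≡M e≢0 with coprime-Bézout t⊥M
... | Bézout.+- x y 1+yM≡xt = x * d , coprime-*ˡ x⊥M d⊥M , y * d , (begin
    t * (x * d)      ≡⟨ solve (t ∷ x ∷ d ∷ []) ⟩
    (x * t) * d      ≡⟨ cong (_* d) (sym 1+yM≡xt) ⟩
    (1 + y * M) * d  ≡⟨ solve (y ∷ M ∷ d ∷ []) ⟩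
    d + y * d * M    ∎)
  where
  open ≡-Reasoning
  x⊥M : Coprime x M
  x⊥M {f} (f∣x , f∣M) = ∣1+n∣n⇒≡1 (subst (f ∣_) (sym 1+yM≡xt) (∣m⇒∣m*n t f∣x)) (∣n⇒∣m*n y f∣M)
... | Bézout.-+ x y 1+xt≡yM =
  x * e , coprime-*ˡ x⊥M (coprime-complement d+e≡M d⊥M) ,
  complement-residue (y * e) (begin
    t * (x * e) + e  ≡⟨ solve (t ∷ x ∷ e ∷ []) ⟩
    (1 + x * t) * e  ≡⟨ cong (_* e) 1+xt≡yM ⟩
    y * M * e        ≡⟨ solve (y ∷ M ∷ e ∷ []) ⟩
    y * e * M        ∎) d+e≡M e≢0
  where
  open ≡-Reasoning
  x⊥M : Coprime x M
  x⊥M {f} (f∣x , f∣M) = ∣1+n∣n⇒≡1 (subst (f ∣_) (sym 1+xt≡yM) (∣n⇒∣m*n y f∣M)) (∣m⇒∣m*n t f∣x)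

%-absorbʳ-* : ∀ m n d .{{_ : NonZero d}} → (m * (n % d)) % d ≡ (m * n) % d
%-absorbʳ-* m n d = begin
  (m * (n % d)) % d              ≡⟨ %-distribˡ-* m (n % d) d ⟩
  ((m % d) * (n % d % d)) % d    ≡⟨ cong (λ x → ((m % d) * x) % d) (m%n%n≡m%n n d) ⟩
  ((m % d) * (n % d)) % d        ≡⟨ sym (%-distribˡ-* m n d) ⟩
  (m * n) % d                    ∎
  where open ≡-Reasoning

unitRep-% : ∀ {N x} .{{_ : NonZero N}} → 2 ≤ N → Coprime x N → IsUnitRep N (x % N)
unitRep-% {N} {x} 2≤N x⊥N = n≢0⇒n>0 x%N≢0 , m%n<n x N , x%N⊥N
  where
  x%N≢0 : x % N ≢ 0
  x%N≢0 x%N≡0 = <⇒≢ 2≤N (sym (x⊥N (m%n≡0⇒n∣m x N x%N≡0 , ∣-refl)))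
  x%N⊥N : Coprime (x % N) N
  x%N⊥N (e∣x%N , e∣N) = x⊥N (∣n∣m%n⇒∣m e∣N e∣x%N , e∣N)

unit-solution : ∀ {N M g t t′ d e} .{{_ : NonZero N}} → 2 ≤ N → N ≡ M * g → t ≡ t′ * g →
                Coprime t′ M → Coprime d M → d + e ≡ M → e ≢ 0 →
                ∃ λ a → IsUnitRep N a × (t * a) % N ≡ (d * g) % N
unit-solution {N} {M} {g} {t} {t′} {d} 2≤N N≡Mg t≡t′g t′⊥M d⊥M d+e≡M e≢0
  with coprime-congruence t′⊥M d⊥M d+e≡M e≢0
... | c , c⊥M , w , t′c≡d+wM with coprime-lift {N = N} c⊥M (≢-nonZero⁻¹ N)
... | k , x⊥N = x % N , unitRep-% 2≤N x⊥N , (begin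
    (t * (x % N)) % N                ≡⟨ %-absorbʳ-* t x N ⟩
    (t * x) % N                      ≡⟨ cong (λ u → (u * x) % N) t≡t′g ⟩
    (t′ * g * (c + M * k)) % N       ≡⟨ cong (_% N) (solve (t′ ∷ g ∷ c ∷ M ∷ k ∷ [])) ⟩
    ((t′ * c) * g + (t′ * k) * (M * g)) % N
      ≡⟨ cong (λ u → (u * g + (t′ * k) * (M * g)) % N) t′c≡d+wM ⟩
    ((d + w * M) * g + (t′ * k) * (M * g)) % N
      ≡⟨ cong (_% N) (solve (d ∷ w ∷ M ∷ g ∷ t′ ∷ k ∷ [])) ⟩
    (d * g + (w + t′ * k) * (M * g)) % N
      ≡⟨ cong (λ u → (d * g + (w + t′ * k) * u) % N) (sym N≡Mg) ⟩
    (d * g + (w + t′ * k) * N) % N   ≡⟨ [m+kn]%n≡m%n (d * g) (w + t′ * k) N ⟩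
    (d * g) % N                      ∎)
  where
  open ≡-Reasoning
  x = c + M * k

-- The exceptions are genuine: there M/n ≤ d ≤ M − M/n has no solution prime to M.
data MidUnit (M n : ℕ) : Set where
  mid            : ∀ d e → d + e ≡ M → Coprime d M → M ≤ n * d → M ≤ n * e → MidUnit M n
  exception-4-3  : M ≡ 4  → n ≡ 3 → MidUnit M n
  exception-6-5  : M ≡ 6  → n ≡ 5 → MidUnit M n
  exception-10-3 : M ≡ 10 → n ≡ 3 → MidUnit M n

mid-≤ : ∀ {M n} k q r d e → k ≤ n → Coprime d r → q * d + r ≡ M → d + e ≡ M →
        M ≤ k * d → M ≤ k * e → MidUnit M n
mid-≤ k q r d e k≤n d⊥r qd+r≡M d+e≡M M≤kd M≤ke =
  mid d e d+e≡M (subst (Coprime d) qd+r≡M (coprime-*+ q d⊥r))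
      (≤-trans M≤kd (*-monoˡ-≤ d k≤n)) (≤-trans M≤ke (*-monoˡ-≤ e k≤n))

data EvenOdd : ℕ → Set where
  even : ∀ k → EvenOdd (2 * k)
  odd  : ∀ k → EvenOdd (1 + 2 * k)

evenOdd : ∀ m → EvenOdd m
evenOdd zero = even 0
evenOdd (suc m) with evenOdd m
... | even k = odd k
... | odd k  = subst EvenOdd (cong suc (+-suc k (k + 0))) (even (suc k))

≤3-absurd : ∀ {M n} → M ≤ 3 → 3 ≤ n → n < M → ⊥
≤3-absurd M≤3 3≤n n<M = <⇒≱ n<M (≤-trans M≤3 3≤n)

coprime-6⇒≡5 : ∀ {n} → 3 ≤ n → n < 6 → Coprime n 6 → n ≡ 5
coprime-6⇒≡5 {1} (s≤s ()) _ _
coprime-6⇒≡5 {2} (s≤s (s≤s ())) _ _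
coprime-6⇒≡5 {3} _ _ 3⊥6 = contradiction (3⊥6 (∣-refl , divides 2 refl)) λ ()
coprime-6⇒≡5 {4} _ _ 4⊥6 = contradiction (4⊥6 {2} (divides 2 refl , divides 3 refl)) λ ()
coprime-6⇒≡5 {5} _ _ _ = refl
coprime-6⇒≡5 {suc (suc (suc (suc (suc (suc _)))))} _ (s≤s (s≤s (s≤s (s≤s (s≤s (s≤s ())))))) _

midUnit-odd : ∀ k {n} → 3 ≤ n → n < 1 + 2 * k → MidUnit (1 + 2 * k) n
midUnit-odd 0 3≤n n<M = ⊥-elim (≤3-absurd (≤-by 2 refl) 3≤n n<M)
midUnit-odd 1 3≤n n<M = ⊥-elim (≤3-absurd ≤-refl 3≤n n<M)
midUnit-odd (suc (suc j)) 3≤n _ =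
  mid-≤ 3 2 1 (2 + j) (3 + j) 3≤n coprime-1ʳ (solve (j ∷ [])) (solve (j ∷ []))
        (≤-by (1 + j) (solve (j ∷ []))) (≤-by (4 + j) (solve (j ∷ [])))

midUnit-4∣ : ∀ j {n} → 3 ≤ n → n < 2 * (2 * j) → MidUnit (2 * (2 * j)) n
midUnit-4∣ 0 3≤n n<M = ⊥-elim (≤3-absurd z≤n 3≤n n<M)
midUnit-4∣ 1 3≤n n<4 = exception-4-3 refl (≤-antisym (≤-pred n<4) 3≤n)
midUnit-4∣ (suc (suc i)) 3≤n _ =
  mid-≤ 3 2 2 (1 + 2 * (1 + i)) (5 + 2 * i) 3≤n (odd⊥2 (1 + i)) (solve (i ∷ [])) (solve (i ∷ []))
        (≤-by (1 + 2 * i) (solve (i ∷ []))) (≤-by (7 + 2 * i) (solve (i ∷ [])))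

midUnit-4∤ : ∀ j {n} → 3 ≤ n → n < 2 * (1 + 2 * j) → Coprime n (2 * (1 + 2 * j)) →
             MidUnit (2 * (1 + 2 * j)) n
midUnit-4∤ 0 3≤n n<M _ = ⊥-elim (≤3-absurd (≤-by 1 refl) 3≤n n<M)
midUnit-4∤ 1 3≤n n<6 n⊥6 = exception-6-5 refl (coprime-6⇒≡5 3≤n n<6 n⊥6)
midUnit-4∤ 2 {n} 3≤n _ _ with n ≟ 3
... | yes n≡3 = exception-10-3 refl n≡3
... | no n≢3  =
  mid-≤ 4 3 1 3 7 (≤∧≢⇒< 3≤n (n≢3 ∘ sym)) coprime-1ʳ refl refl (≤-by 2 refl) (≤-by 18 refl)
midUnit-4∤ (suc (suc (suc i))) 3≤n _ _ =
  mid-≤ 3 2 4 (1 + 2 * (2 + i)) (9 + 2 * i) 3≤n (coprime-*ʳ (odd⊥2 (2 + i)) (odd⊥2 (2 + i)))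
        (solve (i ∷ [])) (solve (i ∷ []))
        (≤-by (1 + 2 * i) (solve (i ∷ []))) (≤-by (13 + 2 * i) (solve (i ∷ [])))

-- d is (M − 1)/2, M/2 − 1 or M/2 − 2, whichever is odd, so that d is prime to M.
midUnit : ∀ M n → 3 ≤ n → n < M → Coprime n M → MidUnit M n
midUnit M n 3≤n n<M n⊥M with evenOdd M
... | odd k = midUnit-odd k 3≤n n<M
... | even k with evenOdd k
...   | even j = midUnit-4∣ j 3≤n n<M
...   | odd j  = midUnit-4∤ j 3≤n n<M n⊥M

-- The three exceptional cases, with g = 2 (1 + m)

odd-unitRep : ∀ {N} x → N ≡ 2 * (1 + 2 * x) + 2 → IsUnitRep N (1 + 2 * x)
odd-unitRep x refl = s≤s z≤n , ≤-by (2 + 2 * x) (solve (x ∷ [])) , coprime-*+ 2 (odd⊥2 x)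

counterexample-4-3 : ∀ {n N s} .{{_ : NonZero N}} m → n ≡ 3 → N ≡ 4 * (2 * suc m) →
                     s ≡ suc (1 * (2 * suc m)) → Counterexample n N s
counterexample-4-3 m refl refl refl =
  counterexample-by-drop (1 + 2 * (2 * m + 1)) (2 * m + 1) (suc m) 1
    (odd-unitRep (2 * m + 1) N≡2a+2) (solve (m ∷ []))
    (≤-by (6 * m + 6) (solve (m ∷ []))) (≤-by (2 * m + 4) (solve (m ∷ [])))
    (≤-by (4 * m + 1) (solve (m ∷ [])))
  where
  N≡2a+2 : 4 * (2 * suc m) ≡ 2 * (1 + 2 * (2 * m + 1)) + 2
  N≡2a+2 = solve (m ∷ [])

counterexample-6-5 : ∀ {n N s} .{{_ : NonZero N}} m → n ≡ 5 → N ≡ 6 * (2 * suc m) →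
                     s ≡ suc (1 * (2 * suc m)) → Counterexample n N s
counterexample-6-5 m refl refl refl =
  counterexample-by-drop (1 + 2 * (3 * m + 2)) (4 * m + 3) (suc m) 2
    (odd-unitRep (3 * m + 2) N≡2a+2) (solve (m ∷ []))
    (≤-by (8 * m + 8) (solve (m ∷ []))) (≤-by (4 * m + 8) (solve (m ∷ [])))
    (≤-by (6 * m + 1) (solve (m ∷ [])))
  where
  N≡2a+2 : 6 * (2 * suc m) ≡ 2 * (1 + 2 * (3 * m + 2)) + 2
  N≡2a+2 = solve (m ∷ [])

-- Here a is coprime to N only because 3 is.
counterexample-10-3-1 : ∀ {n N s} .{{_ : NonZero N}} m → Coprime n N → n ≡ 3 → N ≡ 10 * (2 * suc m) →
                        s ≡ suc (1 * (2 * suc m)) → Counterexample n N s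
counterexample-10-3-1 m 3⊥N refl refl refl =
  counterexample-by-drop (1 + 2 * (5 * m + 3)) (4 * m + 1) (suc m) 1
    (s≤s z≤n , a<N , a⊥N) (solve (m ∷ []))
    (≤-by (16 * m + 18) (solve (m ∷ []))) (≤-by (8 * m + 16) (solve (m ∷ [])))
    (≤-by (10 * m + 1) (solve (m ∷ [])))
  where
  a<N : 1 + 2 * (5 * m + 3) < 10 * (2 * suc m)
  a<N = ≤-by (10 * m + 12) (solve (m ∷ []))
  N≡2a+6 : 10 * (2 * suc m) ≡ 2 * (1 + 2 * (5 * m + 3)) + 3 * 2
  N≡2a+6 = solve (m ∷ [])
  a⊥N : Coprime (1 + 2 * (5 * m + 3)) (10 * (2 * suc m))
  a⊥N {e} (e∣a , e∣N) = odd⊥2 (5 * m + 3) (e∣a , coprime-divisor e⊥3 e∣6)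
    where
    e∣6 : e ∣ 3 * 2
    e∣6 = ∣m+n∣m⇒∣n (subst (e ∣_) N≡2a+6 e∣N) (∣n⇒∣m*n 2 e∣a)
    e⊥3 : Coprime e 3
    e⊥3 = coprime-sym (coprime-∣ʳ e∣N 3⊥N)

counterexample-10-3-3 : ∀ {n N s} .{{_ : NonZero N}} m → n ≡ 3 → N ≡ 10 * (2 * suc m) →
                        s ≡ suc (3 * (2 * suc m)) → Counterexample n N s
counterexample-10-3-3 m refl refl refl =
  counterexample-by-drop (1 + 2 * (5 * m + 4)) (4 * m + 3) (3 * m + 3) 1
    (odd-unitRep (5 * m + 4) N≡2a+2) (solve (m ∷ []))
    (≤-by (16 * m + 16) (solve (m ∷ []))) (≤-by (8 * m + 10) (solve (m ∷ [])))
    (≤-by (10 * m + 7) (solve (m ∷ [])))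
  where
  N≡2a+2 : 10 * (2 * suc m) ≡ 2 * (1 + 2 * (5 * m + 4)) + 2
  N≡2a+2 = solve (m ∷ [])

-- If g were odd, 1 + (1 + 2 j) g and M g would both be even.
coprime-1+odd*g⇒g-even : ∀ {M g j} → 2 ∣ M → g ≢ 0 → Coprime (suc ((1 + 2 * j) * g)) (M * g) →
           ∃ λ m → g ≡ 2 * suc m
coprime-1+odd*g⇒g-even {g = g} {j} 2∣M g≢0 s⊥Mg with evenOdd g
... | even 0       = ⊥-elim (g≢0 refl)
... | even (suc m) = m , refl
... | odd k        = contradiction (s⊥Mg (2∣s , ∣m⇒∣m*n (1 + 2 * k) 2∣M)) λ ()
  where
  2∣s : 2 ∣ suc ((1 + 2 * j) * (1 + 2 * k))
  2∣s = divides (1 + j + k + 2 * j * k) (solve (j ∷ k ∷ []))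

*-<-*2⇒≡1 : ∀ m {x} → x ≢ 0 → m * x < m * 2 → x ≡ 1
*-<-*2⇒≡1 m {x} x≢0 mx<m2 = ≤-antisym (≤-pred (*-cancelˡ-< m x 2 mx<m2)) (n≢0⇒n>0 x≢0)

unit-of-10-<4 : ∀ {x} → x ≢ 0 → x < 4 → Coprime x 10 → x ≡ 1 ⊎ x ≡ 3
unit-of-10-<4 {0} x≢0 _ _ = ⊥-elim (x≢0 refl)
unit-of-10-<4 {1} _ _ _ = inj₁ refl
unit-of-10-<4 {2} _ _ 2⊥10 = contradiction (2⊥10 (∣-refl , divides 5 refl)) λ ()
unit-of-10-<4 {3} _ _ _ = inj₂ refl
unit-of-10-<4 {suc (suc (suc (suc _)))} _ (s≤s (s≤s (s≤s (s≤s ())))) _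

module _ {n N t g M t′ : ℕ} .{{_ : NonZero N}} (3≤n : 3 ≤ n) (2≤N : 2 ≤ N) (n⊥N : Coprime n N)
         (t≢0 : t ≢ 0) (nt<N : n * t < N) (s⊥N : Coprime (suc t) N)
         (N≡Mg : N ≡ M * g) (t≡t′g : t ≡ t′ * g) (t′⊥M : Coprime t′ M) where

  private
    g≢0 : g ≢ 0
    g≢0 g≡0 = ≢-nonZero⁻¹ N (trans N≡Mg (trans (cong (M *_) g≡0) (*-zeroʳ M)))
    t′≢0 : t′ ≢ 0
    t′≢0 t′≡0 = t≢0 (trans t≡t′g (cong (_* g) t′≡0))
    n⊥M : Coprime n M
    n⊥M = coprime-∣ʳ (divides g (trans N≡Mg (*-comm M g))) n⊥N

    nt′<M : n * t′ < M
    nt′<M = *-cancelʳ-< g (n * t′) M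
              (subst₂ _<_ (trans (cong (n *_) t≡t′g) (sym (*-assoc n t′ g))) N≡Mg nt<N)
    nt′<M-at : ∀ {n₀ M₀} → n ≡ n₀ → M ≡ M₀ → n₀ * t′ < M₀
    nt′<M-at n≡n₀ M≡M₀ = subst₂ (λ x y → x * t′ < y) n≡n₀ M≡M₀ nt′<M
    n<M : n < M
    n<M = ≤-<-trans (m≤m*n n t′ {{≢-nonZero t′≢0}}) nt′<M

    scaled : ∀ {x} → M ≤ n * x → N ≤ n * (x * g)
    scaled {x} M≤nx = begin
      N          ≡⟨ N≡Mg ⟩
      M * g      ≤⟨ *-monoˡ-≤ g M≤nx ⟩
      n * x * g  ≡⟨ *-assoc n x g ⟩
      n * (x * g) ∎
      where open ≤-Reasoning

    even-shape : ∀ {M₀} j → M ≡ M₀ → 2 ∣ M₀ → t′ ≡ 1 + 2 * j →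
                 ∃ λ m → N ≡ M₀ * (2 * suc m) × suc t ≡ suc ((1 + 2 * j) * (2 * suc m))
    even-shape {M₀} j M≡M₀ 2∣M₀ t′≡1+2j =
      let m , g≡2[1+m] = coprime-1+odd*g⇒g-even {M₀} {g} {j} 2∣M₀ g≢0 s⊥M₀g
      in  m , trans N≡Mg (cong₂ _*_ M≡M₀ g≡2[1+m]) ,
          cong suc (trans t≡t′g (cong₂ _*_ t′≡1+2j g≡2[1+m]))
      where
      s⊥M₀g : Coprime (suc ((1 + 2 * j) * g)) (M₀ * g)
      s⊥M₀g = subst₂ (λ x y → Coprime (suc (x * g)) y) t′≡1+2j (trans N≡Mg (cong (_* g) M≡M₀))
                (subst (λ x → Coprime (suc x) N) t≡t′g s⊥N)

    counterexample-of-midUnit : MidUnit M n → Counterexample n N (suc t)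
    counterexample-of-midUnit (mid d e d+e≡M d⊥M M≤nd M≤ne) =
      jump (unit-solution 2≤N N≡Mg t≡t′g t′⊥M d⊥M d+e≡M e≢0)
      where
      e≢0 : e ≢ 0
      e≢0 e≡0 = <⇒≱ (≤-<-trans z≤n n<M)
                    (≤-trans M≤ne (≤-reflexive (trans (cong (n *_) e≡0) (*-zeroʳ n))))
      dg+eg≡N : d * g + e * g ≡ N
      dg+eg≡N = trans (sym (*-distribʳ-+ g d e)) (trans (cong (_* g) d+e≡M) (sym N≡Mg))
      jump : (∃ λ a → IsUnitRep N a × (t * a) % N ≡ (d * g) % N) → Counterexample n N (suc t)
      jump (a , a-unit , ta≡dg) =
        counterexample-by-jump a-unit ta≡dg dg+eg≡N (scaled M≤nd) (scaled M≤ne)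
    counterexample-of-midUnit (exception-4-3 M≡4 n≡3) =
      let m , N≡ , s≡ = even-shape 0 M≡4 (divides 2 refl) t′≡1
      in  counterexample-4-3 m n≡3 N≡ s≡
      where
      t′≡1 : t′ ≡ 1
      t′≡1 = *-<-*2⇒≡1 3 t′≢0 (<-≤-trans (nt′<M-at n≡3 M≡4) (≤-by 2 refl))
    counterexample-of-midUnit (exception-6-5 M≡6 n≡5) =
      let m , N≡ , s≡ = even-shape 0 M≡6 (divides 3 refl) t′≡1
      in  counterexample-6-5 m n≡5 N≡ s≡
      where
      t′≡1 : t′ ≡ 1
      t′≡1 = *-<-*2⇒≡1 5 t′≢0 (<-≤-trans (nt′<M-at n≡5 M≡6) (≤-by 4 refl))
    counterexample-of-midUnit (exception-10-3 M≡10 n≡3) =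
      by-t′ (unit-of-10-<4 t′≢0 t′<4 (subst (Coprime t′) M≡10 t′⊥M))
      where
      t′<4 : t′ < 4
      t′<4 = *-cancelˡ-< 3 t′ 4 (<-≤-trans (nt′<M-at n≡3 M≡10) (≤-by 2 refl))
      by-t′ : t′ ≡ 1 ⊎ t′ ≡ 3 → Counterexample n N (suc t)
      by-t′ (inj₁ t′≡1) = let m , N≡ , s≡ = even-shape 0 M≡10 (divides 5 refl) t′≡1
                          in  counterexample-10-3-1 m n⊥N n≡3 N≡ s≡
      by-t′ (inj₂ t′≡3) = let m , N≡ , s≡ = even-shape 1 M≡10 (divides 5 refl) t′≡3
                          in  counterexample-10-3-3 m n≡3 N≡ s≡

  counterexample-of-split : Counterexample n N (suc t)
  counterexample-of-split = counterexample-of-midUnit (midUnit M n 3≤n n<M n⊥M)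

counterexample-of-shift : ∀ {n N t} .{{_ : NonZero N}} → 3 ≤ n → 2 ≤ N → Coprime n N →
                          t ≢ 0 → n * t < N → Coprime (suc t) N → Counterexample n N (suc t)
counterexample-of-shift {n} {N} {t} 3≤n 2≤N n⊥N t≢0 nt<N s⊥N =
  counterexample-of-split 3≤n 2≤N n⊥N t≢0 nt<N s⊥N
    (sym (m/n*n≡m (gcd[m,n]∣n t N))) (sym (m/n*n≡m (gcd[m,n]∣m t N))) (coprime-/gcd t N)
  where
  instance
    gcd-nonZero : NonZero (gcd t N)
    gcd-nonZero = ≢-nonZero (gcd[m,n]≢0 t N (inj₁ t≢0))

h-1≢h : ∀ {n N s} .{{_ : NonZero N}} → 2 ≤ s → N ≤ n * s → h n N 1 ≢ h n N s
h-1≢h {n} {N} {s} 2≤s N≤ns with n <? N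
... | yes n<N = /-≢-across 1 (subst₂ _<_ (sym (*-identityʳ n)) (sym (*-identityˡ N)) n<N)
                             (subst (_≤ n * s) (sym (*-identityˡ N)) N≤ns)
... | no n≮N  = /-≢-if-+≤ (begin
  n * 1 + N  ≤⟨ +-monoʳ-≤ (n * 1) (≮⇒≥ n≮N) ⟩
  n * 1 + n  ≡⟨ solve (n ∷ []) ⟩
  n * 2      ≤⟨ *-monoʳ-≤ n 2≤s ⟩
  n * s      ∎)
  where open ≤-Reasoning

invariant⇒n*s<N : ∀ {n N s} .{{_ : NonZero N}} → 2 ≤ N → 2 ≤ s → s < N → Invariant n N s → n * s < N
invariant⇒n*s<N {n} {N} {s} 2≤N 2≤s s<N inv with n * s <? N
... | yes ns<N = ns<N
... | no ns≮N  = contradiction (sym (trans (cong (h n N) (sym θ1≡s)) (inv 1 1-unit)))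
                               (h-1≢h {n} 2≤s (≮⇒≥ ns≮N))
  where
  1-unit : IsUnitRep N 1
  1-unit = ≤-refl , 2≤N , coprime-sym coprime-1ʳ
  θ1≡s : θ N s 1 ≡ s
  θ1≡s = trans (cong (_% N) (*-identityʳ s)) (m<n⇒m%n≡m s<N)

≡1⇒invariant : ∀ {n N s} .{{_ : NonZero N}} → s ≡ 1 → Invariant n N s
≡1⇒invariant {n} {N} refl a (_ , a<N , _) =
  cong (h n N) (trans (cong (_% N) (*-identityˡ a)) (m<n⇒m%n≡m a<N))

invariant⇒≡1 : ∀ {n N s} .{{_ : NonZero N}} → 3 ≤ n → 2 ≤ N → Coprime n N →
               IsUnitRep N s → Invariant n N s → s ≡ 1
invariant⇒≡1 {s = 1} _ _ _ _ _ = refl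
invariant⇒≡1 {n} {N} {suc (suc t)} 3≤n 2≤N n⊥N (_ , s<N , s⊥N) inv =
  contradiction inv
    (counterexample⇒¬invariant {n} (counterexample-of-shift 3≤n 2≤N n⊥N (λ ()) n[1+t]<N s⊥N))
  where
  n[1+t]<N : n * suc t < N
  n[1+t]<N = ≤-<-trans (*-monoʳ-≤ n (n≤1+n (suc t)))
                       (invariant⇒n*s<N {n} 2≤N (s≤s (s≤s z≤n)) s<N inv)

proposition5p3 : (n N : ℕ) .{{_ : NonZero N}} → 3 ≤ n → 2 ≤ N → Coprime n N →
    (s : ℕ) → IsUnitRep N s →
    ((∀ a → IsUnitRep N a → h n N (θ N s a) ≡ h n N a) ⇔ (s ≡ 1))
proposition5p3 n N 3≤n 2≤N n⊥N s s-unit =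
  mk⇔ (invariant⇒≡1 {n} 3≤n 2≤N n⊥N s-unit) (≡1⇒invariant {n})
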